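{- Let $G=(V,E)$ be a finite undirected graph and let $B$ be a positive integer with $B \le |V|$. Suppose $X=\{x_{v,i} : v\in V,\ i\in\{1,\dots,B\}\}$ is a feasible solution of the integer program GBP-IP$(G,B)$ defined below. Then there exists a burning sequence $S$ of length $B$ for $G$ such that for every $v\in V$ and every $i\in\{1,\dots,B\}$, if $x_{v,i}=1$ then $v$ is the $i$-th fire source of $S$ (i.e., the $i$-th entry of $S$).
   Context: For vertices $u,v$ of $G$, $d(u,v)$ denotes the number of edges of a shortest $u$–$v$ path in $G$ ($\infty$ if none exists). For $u\in V$ and integer $j\ge 0$, $N_j[u]=\{v\in V : d(u,v)\le j\}$. A sequence $(v_1,\dots,v_k)\in V^k$ is a burning sequence for $G$ (of length $k$; its $i$-th entry $v_i$ is called the $i$-th fire source) if $\bigcup_{i=1}^{k} N_{k-i}[v_i]=V$. The integer program GBP-IP$(G,B)$, for a positive integer $B\le |V|$, has binary variables $x_{v,i}\in\{0,1\}$ for $v\in V$, $i\in\{1,\dots,B\}$, no objective (feasibility problem), and constraints: (i) $\sum_{i=1}^{B} x_{v,i}\le 1$ for all $v\in V$; (ii) $\sum_{v\in V} x_{v,i}=1$ for all $i\in\{1,\dots,B\}$; (iii) $\sum_{i=1}^{B}\sum_{u\in V:\ v\in N_{B-i}[u]} x_{u,i}\ge 1$ for all $v\in V$. A feasible solution is an assignment of values in $\{0,1\}$ to all variables satisfying (i)–(iii). -}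

module Defs where

open import Data.Nat using (ℕ; zero; suc; _+_; _∸_; _≤_)
open import Data.Fin using (Fin; toℕ)
open import Data.Fin.Properties using (_≟_)
open import Data.Bool using (Bool; true; false; _∨_; _∧_; if_then_else_)
open import Data.Product using (Σ; _×_; ∃)
open import Relation.Nullary.Decidable using (⌊_⌋)
open import Relation.Binary.PropositionalEquality using (_≡_)

record Graph (n : ℕ) : Set where
  field
    adj     : Fin n → Fin n → Bool
    sym     : ∀ u v → adj u v ≡ adj v u
    irrefl  : ∀ u → adj u u ≡ false
open Graph public

sumFin : ∀ {n} → (Fin n → ℕ) → ℕ
sumFin {zero}  f = 0
sumFin {suc n} f = f Fin.zero + sumFin (λ i → f (Fin.suc i))

anyFin : ∀ {n} → (Fin n → Bool) → Bool
anyFin {zero}  f = false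
anyFin {suc n} f = f Fin.zero ∨ anyFin (λ i → f (Fin.suc i))

-- Walk-relation: withinDist G j u v = true iff there is a u–v walk with at
-- most j edges, i.e. d(u,v) ≤ j (with d = ∞ if no path exists).
withinDist : ∀ {n} → Graph n → ℕ → Fin n → Fin n → Bool
withinDist G zero    u v = ⌊ u ≟ v ⌋
withinDist G (suc j) u v =
  withinDist G j u v ∨ anyFin (λ w → withinDist G j u w ∧ adj G w v)

_∈N[_,_]_ : ∀ {n} → Fin n → ℕ → Fin n → Graph n → Set
v ∈N[ j , u ] G = withinDist G j u v ≡ true

-- Burning sequence of length k: S : Fin k → Fin n, where S i is the
-- (toℕ i + 1)-th fire source; requires ⋃_i N_{k-(toℕ i+1)}[S i] = V.
IsBurningSequence : ∀ {n} → Graph n → (k : ℕ) → (Fin k → Fin n) → Set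
IsBurningSequence {n} G k S =
  ∀ (v : Fin n) → ∃ λ (i : Fin k) → v ∈N[ k ∸ suc (toℕ i) , S i ] G

[_] : Bool → ℕ
[ true ]  = 1
[ false ] = 0

-- Feasibility of GBP-IP(G,B). The binary variables x_{v,i} are encoded as
-- x : Fin n → Fin B → Bool (x v i stands for x_{v, toℕ i + 1}).
FeasibleGBP : ∀ {n} → Graph n → (B : ℕ) → (Fin n → Fin B → Bool) → Set
FeasibleGBP {n} G B x =
    (∀ (v : Fin n) → sumFin (λ i → [ x v i ]) ≤ 1)
  × (∀ (i : Fin B) → sumFin (λ v → [ x v i ]) ≡ 1)
  × (∀ (v : Fin n) →
       1 ≤ sumFin (λ i → sumFin (λ u →
              if withinDist G (B ∸ suc (toℕ i)) u v then [ x u i ] else 0)))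

-- Constraint (ii) says that column i of x contains exactly one 1; taking that
-- vertex as the i-th fire source defines S, and agrees with x by uniqueness.
-- Constraint (iii) provides, for each vertex v, some i and u with x_{u,i} = 1
-- and v ∈ N_{B-i}[u]; as u = S i, the sources cover V.
module Submission where

open import Defs
open import Data.Nat using (ℕ; zero; suc; _∸_; _≤_; z≤n; s≤s)
open import Data.Nat.Properties using (≤-reflexive; ≤-trans; m≤m+n; m≤n+m; +-mono-≤)
open import Data.Fin using (Fin; toℕ)
open import Data.Bool using (Bool; true; if_then_else_)
open import Data.Product using (_×_; ∃; _,_; proj₁; proj₂)
open import Relation.Binary.PropositionalEquality as ≡ using (_≡_; refl; cong; subst)

term≤sumFin : ∀ {n} (f : Fin n → ℕ) (i : Fin n) → f i ≤ sumFin f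
term≤sumFin f Fin.zero    = m≤m+n _ _
term≤sumFin f (Fin.suc i) = ≤-trans (term≤sumFin (λ j → f (Fin.suc j)) i) (m≤n+m _ (f Fin.zero))

sumFin-pos⇒∃-pos : ∀ {n} (f : Fin n → ℕ) → 1 ≤ sumFin f → ∃ λ i → 1 ≤ f i
sumFin-pos⇒∃-pos {suc n} f h with f Fin.zero in eq
... | suc _ = Fin.zero , subst (1 ≤_) (≡.sym eq) (s≤s z≤n)
... | zero  with sumFin-pos⇒∃-pos (λ i → f (Fin.suc i)) h
...   | i , p = Fin.suc i , p

[]-pos⇒true : ∀ b → 1 ≤ [ b ] → b ≡ true
[]-pos⇒true true _ = refl

true⇒[]-pos : ∀ {b} → b ≡ true → 1 ≤ [ b ]
true⇒[]-pos refl = s≤s z≤n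

count : ∀ {n} → (Fin n → Bool) → ℕ
count p = sumFin (λ i → [ p i ])

true⇒count-pos : ∀ {n} (p : Fin n → Bool) {a : Fin n} → p a ≡ true → 1 ≤ count p
true⇒count-pos p {a} pa = ≤-trans (true⇒[]-pos pa) (term≤sumFin (λ i → [ p i ]) a)

count-pos⇒∃ : ∀ {n} (p : Fin n → Bool) → 1 ≤ count p → ∃ λ i → p i ≡ true
count-pos⇒∃ p h with sumFin-pos⇒∃-pos (λ i → [ p i ]) h
... | i , q = i , []-pos⇒true (p i) q

count≤1⇒unique : ∀ {n} (p : Fin n → Bool) {a b : Fin n} → count p ≤ 1 →
  p a ≡ true → p b ≡ true → a ≡ b
count≤1⇒unique p {Fin.zero}  {Fin.zero}  _ _ _ = refl
count≤1⇒unique p {Fin.zero}  {Fin.suc b} h pa pb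
  with ≤-trans (+-mono-≤ (true⇒[]-pos pa) (true⇒count-pos (λ i → p (Fin.suc i)) pb)) h
... | s≤s ()
count≤1⇒unique p {Fin.suc a} {Fin.zero}  h pa pb = ≡.sym (count≤1⇒unique p h pb pa)
count≤1⇒unique p {Fin.suc a} {Fin.suc b} h pa pb =
  cong Fin.suc (count≤1⇒unique (λ i → p (Fin.suc i)) (≤-trans (m≤n+m _ [ p Fin.zero ]) h) pa pb)

if-pos⇒both : ∀ c b → 1 ≤ (if c then [ b ] else 0) → c ≡ true × b ≡ true
if-pos⇒both true b h = refl , []-pos⇒true b h

proposition1 : ∀ {n : ℕ} (G : Graph n) (B : ℕ) → 1 ≤ B → B ≤ n →
    (x : Fin n → Fin B → Bool) → FeasibleGBP G B x →
    ∃ λ (S : Fin B → Fin n) → IsBurningSequence G B S ×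
    (∀ (v : Fin n) (i : Fin B) → x v i ≡ true → S i ≡ v)
proposition1 {n} G B _ _ x (_ , column-one , covered) = S , burns , agrees
  where
  column : Fin B → Fin n → Bool
  column i v = x v i

  source : ∀ i → ∃ λ v → x v i ≡ true
  source i = count-pos⇒∃ (column i) (≤-reflexive (≡.sym (column-one i)))

  S : Fin B → Fin n
  S i = proj₁ (source i)

  agrees : ∀ v i → x v i ≡ true → S i ≡ v
  agrees v i = count≤1⇒unique (column i) (≤-reflexive (column-one i)) (proj₂ (source i))

  burns : IsBurningSequence G B S
  burns v with sumFin-pos⇒∃-pos _ (covered v)
  ... | i , hi with sumFin-pos⇒∃-pos _ hi
  ...   | u , hu with if-pos⇒both (withinDist G (B ∸ suc (toℕ i)) u v) (x u i) hu
  ...     | near , xui =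
    i , subst (λ s → v ∈N[ B ∸ suc (toℕ i) , s ] G) (≡.sym (agrees u i xui)) near
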